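{- Let $k,\ell$ be positive odd integers with $\ell>k$. For all integers $n \geq 2$ and all divisors $d$ of $n$ with $1 \leq d < n$, we have \[ a_{k,\ell}(n,d) < n^{3\ell}d^{3k}\left(1 + \frac{1}{n^{\ell} - 1}\right). \] Furthermore, for all $n \geq 2$, \[ |a_{k,\ell}(n,n)| > n^{2k+3\ell}\left(1 - \frac{1}{n^2}\right). \]
   Context: For positive integers $n$ and $d\mid n$, define \[ a_{k,\ell}(n,d) := (n^{3\ell} + n^{2\ell} + n^{\ell} + 1)\, d^{3k} - (n^{3k} + n^{2k} + n^{k} + 1)\, d^{3\ell}. \] -}

module Defs where

open import Data.Nat using (ℕ; zero; suc; _+_; _*_; _^_)
open import Data.Integer using (ℤ; +_; _-_) renaming (_*_ to _*ℤ_)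
open import Data.Rational using (ℚ; _/_; 0ℚ)
open import Data.Product using (∃)
open import Relation.Binary.PropositionalEquality using (_≡_)

Odd : ℕ → Set
Odd k = ∃ λ i → k ≡ 2 * i + 1

S : ℕ → ℕ → ℕ
S n j = n ^ (3 * j) + n ^ (2 * j) + n ^ j + 1

a : ℕ → ℕ → ℕ → ℕ → ℤ
a k ℓ n d = (+ S n ℓ) *ℤ (+ (d ^ (3 * k))) - (+ S n k) *ℤ (+ (d ^ (3 * ℓ)))

-- reciprocal 1/m of a natural number as a rational; only ever applied to m ≥ 1
-- (the value at 0 is an irrelevant convention)
recip : ℕ → ℚ
recip zero = 0ℚ
recip (suc m) = (+ 1) / suc m

-- Put x = n^ℓ and u = n^k, so that S n ℓ = x³ + x² + x + 1 and S n k = u³ + u² + u + 1.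
-- First bound: a(n,d) ≤ (x³ + x² + x + 1) d^{3k}, and (x³ + x² + x + 1)(x − 1) = x⁴ − 1 < x⁴
-- gives exactly a(n,d) < x³ d^{3k} · x/(x − 1) = x³ d^{3k} (1 + 1/(x − 1)).
-- Second bound: |a(n,n)| = (u³ + u² + u + 1) x³ − (x³ + x² + x + 1) u³. As k and ℓ are odd,
-- ℓ ≥ k + 2, hence u n² ≤ x; comparing the two expansions term by term then shows
-- n² |a(n,n)| > u² x³ (n² − 1), which is the claim since u² x³ = n^{2k+3ℓ}.
module Submission where

open import Defs
open import Data.Nat using (ℕ; suc; _+_; _*_; _^_; _∸_; _≤_; _<_; s≤s; z<s; NonZero; >-nonZero)
open import Data.Nat.Properties
open import Data.Nat.Divisibility using (_∣_)
open import Data.Nat.Tactic.RingSolver using (solve-∀)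
open import Data.Integer using (ℤ; +_; ∣_∣)
import Data.Integer as ℤ
import Data.Integer.Properties as ℤ
open import Data.Rational using (1ℚ; _/_; toℚᵘ) renaming (_+_ to _+ℚ_; _-_ to _-ℚ_; _*_ to _*ℚ_; _<_ to _<ℚ_; _>_ to _>ℚ_)
import Data.Rational as ℚ
open import Data.Rational.Properties using (toℚᵘ-fromℚᵘ; toℚᵘ-cancel-<; toℚᵘ-injective; toℚᵘ-homo-+; toℚᵘ-homo-*; toℚᵘ-homo‿-)
open import Data.Rational.Unnormalised using (mkℚᵘ; *<*) renaming (_≃_ to _≃ᵘ_; _+_ to _+ᵘ_; _-_ to _-ᵘ_; _*_ to _*ᵘ_)
import Data.Rational.Unnormalised.Properties as ℚᵘ
open import Data.Product using (_×_; _,_)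
open import Function using (_∘_)
open import Relation.Binary.PropositionalEquality

^-*-comm : ∀ n c j → n ^ (c * j) ≡ (n ^ j) ^ c
^-*-comm n c j = trans (cong (n ^_) (*-comm c j)) (sym (^-*-assoc n j c))

S-^ : ∀ n j → S n j ≡ S (n ^ j) 1
S-^ n j = begin
  n ^ (3 * j) + n ^ (2 * j) + n ^ j + 1        ≡⟨ cong₂ (λ p q → p + q + n ^ j + 1) (^-*-comm n 3 j) (^-*-comm n 2 j) ⟩
  (n ^ j) ^ 3 + (n ^ j) ^ 2 + n ^ j + 1        ≡⟨ cong (λ r → (n ^ j) ^ 3 + (n ^ j) ^ 2 + r + 1) (^-identityʳ (n ^ j)) ⟨
  (n ^ j) ^ 3 + (n ^ j) ^ 2 + (n ^ j) ^ 1 + 1  ∎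
  where open ≡-Reasoning

-- The solver does not unfold _^_, so its equations spell powers out as the products they reduce to.
S-geometric< : ∀ y {D} → 1 ≤ D → S (suc y) 1 * D * y < suc y ^ 3 * D * suc y
S-geometric< y {D} 1≤D = subst (S (suc y) 1 * D * y <_) (geometric y D) (m<m+n _ 1≤D)
  where
  geometric : ∀ y D → let x = suc y in
    (x * (x * (x * 1)) + x * (x * 1) + x * 1 + 1) * D * y + D ≡ x * (x * (x * 1)) * D * x
  geometric = solve-∀

S-cross-gap : ∀ {u x T} → u < x → u * T ≤ x → 0 < T →
  S x 1 * u ^ 3 * T + u ^ 2 * x ^ 3 * T < S u 1 * x ^ 3 * T + u ^ 2 * x ^ 3
S-cross-gap {u} {x} {T} u<x uT≤x 0<T = begin-strict
  S x 1 * u ^ 3 * T + u ^ 2 * x ^ 3 * T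
    ≡⟨ lhs-split u x T ⟩
  x ^ 3 * u ^ 3 * T + (x ^ 2 * u ^ 2 * (u * T) + (x * u * u ^ 2 * T + (u ^ 3 * T + u ^ 2 * x ^ 3 * T)))
    <⟨ +-monoʳ-< (x ^ 3 * u ^ 3 * T)
         (+-mono-≤-< (*-monoʳ-≤ (x ^ 2 * u ^ 2) uT≤x)
         (+-mono-≤-< (*-monoˡ-≤ T (*-monoʳ-≤ (x * u) (^-monoˡ-≤ 2 (<⇒≤ u<x))))
         (+-monoˡ-< (u ^ 2 * x ^ 3 * T) (*-monoˡ-< T {{>-nonZero 0<T}} (^-monoˡ-< 3 u<x))))) ⟩
  x ^ 3 * u ^ 3 * T + (x ^ 2 * u ^ 2 * x + (x * u * x ^ 2 * T + (x ^ 3 * T + u ^ 2 * x ^ 3 * T)))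
    ≡⟨ rhs-split u x T ⟨
  S u 1 * x ^ 3 * T + u ^ 2 * x ^ 3 ∎
  where
  open ≤-Reasoning
  lhs-split : ∀ u x T →
    (x * (x * (x * 1)) + x * (x * 1) + x * 1 + 1) * (u * (u * (u * 1))) * T + u * (u * 1) * (x * (x * (x * 1))) * T
    ≡ x * (x * (x * 1)) * (u * (u * (u * 1))) * T + (x * (x * 1) * (u * (u * 1)) * (u * T)
      + (x * u * (u * (u * 1)) * T + (u * (u * (u * 1)) * T + u * (u * 1) * (x * (x * (x * 1))) * T)))
  lhs-split = solve-∀
  rhs-split : ∀ u x T →
    (u * (u * (u * 1)) + u * (u * 1) + u * 1 + 1) * (x * (x * (x * 1))) * T + u * (u * 1) * (x * (x * (x * 1)))
    ≡ x * (x * (x * 1)) * (u * (u * (u * 1))) * T + (x * (x * 1) * (u * (u * 1)) * x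
      + (x * u * (x * (x * 1)) * T + (x * (x * (x * 1)) * T + u * (u * 1) * (x * (x * (x * 1))) * T)))
  rhs-split = solve-∀

scaled-gap⇒< : ∀ A B R m → A * suc m + R * suc m < B * suc m + R → A < B
scaled-gap⇒< A B R m h = *-cancelʳ-< (suc m) A B (+-cancelʳ-< R (A * suc m) (B * suc m)
  (≤-<-trans (+-monoʳ-≤ (A * suc m) (m≤m*n R (suc m))) h))

scaled-gap⇒∸-bound : ∀ A B R m → A * suc m + R * suc m < B * suc m + R → R * m < (B ∸ A) * suc m
scaled-gap⇒∸-bound A B R m h = +-cancelʳ-< R (R * m) ((B ∸ A) * suc m) (+-cancelˡ-< (A * suc m) _ _ (begin-strict
  A * suc m + (R * m + R)             ≡⟨ cong (λ t → A * suc m + t) (trans (+-comm (R * m) R) (sym (*-suc R m))) ⟩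
  A * suc m + R * suc m               <⟨ h ⟩
  B * suc m + R                       ≡⟨ cong (λ b → b * suc m + R) (m∸n+n≡m (<⇒≤ (scaled-gap⇒< A B R m h))) ⟨
  (B ∸ A + A) * suc m + R             ≡⟨ regroup (B ∸ A) A (suc m) R ⟩
  A * suc m + ((B ∸ A) * suc m + R)   ∎))
  where
  open ≤-Reasoning
  regroup : ∀ K A T R → (K + A) * T + R ≡ A * T + (K * T + R)
  regroup = solve-∀

odd-gap : ∀ {k ℓ} → Odd k → Odd ℓ → k < ℓ → k + 2 ≤ ℓ
odd-gap {ℓ = ℓ} (i , refl) (j , refl) k<ℓ = subst (_≤ ℓ) (shift i) (+-monoˡ-≤ 1 (*-monoʳ-≤ 2 i<j))
  where
  i<j : i < j
  i<j = *-cancelˡ-< 2 i j (+-cancelʳ-< 1 (2 * i) (2 * j) k<ℓ)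
  shift : ∀ i → 2 * suc i + 1 ≡ 2 * i + 1 + 2
  shift = solve-∀

∣m-n∣≡n∸m : ∀ {m n} → m ≤ n → ∣ + m ℤ.- + n ∣ ≡ n ∸ m
∣m-n∣≡n∸m {m} {n} m≤n = begin
  ∣ + m ℤ.- + n ∣   ≡⟨ ℤ.∣i-j∣≡∣j-i∣ (+ m) (+ n) ⟩
  ∣ + n ℤ.- + m ∣   ≡⟨ cong ∣_∣ (ℤ.m-n≡m⊖n n m) ⟩
  ∣ n ℤ.⊖ m ∣       ≡⟨ cong ∣_∣ (ℤ.⊖-≥ m≤n) ⟩
  n ∸ m             ∎
  where open ≡-Reasoning

toℚᵘ-/ : ∀ z m → toℚᵘ (z / suc m) ≃ᵘ mkℚᵘ z m
toℚᵘ-/ z m = toℚᵘ-fromℚᵘ (mkℚᵘ z m)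

/-<-/ : ∀ z w m n → z ℤ.* + suc n ℤ.< w ℤ.* + suc m → z / suc m <ℚ w / suc n
/-<-/ z w m n h = toℚᵘ-cancel-<
  (ℚᵘ.<-respˡ-≃ (ℚᵘ.≃-sym (toℚᵘ-/ z m)) (ℚᵘ.<-respʳ-≃ (ℚᵘ.≃-sym (toℚᵘ-/ w n)) (*<* h)))

1+recip-suc : ∀ m → 1ℚ +ℚ recip (suc m) ≡ + suc (suc m) / suc m
1+recip-suc m = toℚᵘ-injective (begin
  toℚᵘ (1ℚ +ℚ recip (suc m))          ≈⟨ toℚᵘ-homo-+ 1ℚ (recip (suc m)) ⟩
  toℚᵘ 1ℚ +ᵘ toℚᵘ (recip (suc m))     ≈⟨ ℚᵘ.+-congʳ (toℚᵘ 1ℚ) (toℚᵘ-/ (+ 1) m) ⟩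
  mkℚᵘ (+ 1) 0 +ᵘ mkℚᵘ (+ 1) m        ≡⟨ ℚᵘ.↥↧≡⇒≡ (cong (+_ ∘ suc) (trans (cong (_+ 1) (+-identityʳ m)) (+-comm m 1)))
                                                    (cong suc (+-identityʳ m)) ⟩
  mkℚᵘ (+ suc (suc m)) m              ≈⟨ toℚᵘ-/ (+ suc (suc m)) m ⟨
  toℚᵘ (+ suc (suc m) / suc m)        ∎)
  where open ℚᵘ.≃-Reasoning

1-recip-suc : ∀ m → 1ℚ -ℚ recip (suc m) ≡ + m / suc m
1-recip-suc m = toℚᵘ-injective (begin
  toℚᵘ (1ℚ -ℚ recip (suc m))              ≈⟨ toℚᵘ-homo-+ 1ℚ (ℚ.- recip (suc m)) ⟩
  toℚᵘ 1ℚ +ᵘ toℚᵘ (ℚ.- recip (suc m))     ≈⟨ ℚᵘ.+-congʳ (toℚᵘ 1ℚ) (ℚᵘ.≃-trans (toℚᵘ-homo‿- (recip (suc m)))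
                                                                       (ℚᵘ.-‿cong (toℚᵘ-/ (+ 1) m))) ⟩
  mkℚᵘ (+ 1) 0 -ᵘ mkℚᵘ (+ 1) m            ≡⟨ ℚᵘ.↥↧≡⇒≡ (cong +_ (+-identityʳ m)) (cong suc (+-identityʳ m)) ⟩
  mkℚᵘ (+ m) m                            ≈⟨ toℚᵘ-/ (+ m) m ⟨
  toℚᵘ (+ m / suc m)                      ∎)
  where open ℚᵘ.≃-Reasoning

*ℚ-/ : ∀ p q m → (+ p / 1) *ℚ (+ q / suc m) ≡ + (p * q) / suc m
*ℚ-/ p q m = toℚᵘ-injective (begin
  toℚᵘ ((+ p / 1) *ℚ (+ q / suc m))        ≈⟨ toℚᵘ-homo-* (+ p / 1) (+ q / suc m) ⟩
  toℚᵘ (+ p / 1) *ᵘ toℚᵘ (+ q / suc m)     ≈⟨ ℚᵘ.*-cong (toℚᵘ-/ (+ p) 0) (toℚᵘ-/ (+ q) m) ⟩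
  mkℚᵘ (+ p) 0 *ᵘ mkℚᵘ (+ q) m             ≡⟨ ℚᵘ.↥↧≡⇒≡ (sym (ℤ.pos-* p q)) (*-identityˡ (suc m)) ⟩
  mkℚᵘ (+ (p * q)) m                       ≈⟨ toℚᵘ-/ (+ (p * q)) m ⟨
  toℚᵘ (+ (p * q) / suc m)                 ∎)
  where open ℚᵘ.≃-Reasoning

fraction-bound⁺ : ∀ x D (z : ℤ) → 2 ≤ x → 1 ≤ D → z ℤ.≤ + (S x 1 * D) →
  z / 1 <ℚ (+ (x ^ 3 * D) / 1) *ℚ (1ℚ +ℚ recip (x ∸ 1))
fraction-bound⁺ x@(suc (suc m)) D z (s≤s (s≤s _)) 1≤D z≤SD =
  subst (z / 1 <ℚ_) (sym rhs≡) (/-<-/ z (+ (x ^ 3 * D * x)) 0 m (begin-strict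
    z ℤ.* + suc m                     ≤⟨ ℤ.*-monoʳ-≤-nonNeg (+ suc m) z≤SD ⟩
    + (S x 1 * D) ℤ.* + suc m         ≡⟨ ℤ.pos-* (S x 1 * D) (suc m) ⟨
    + (S x 1 * D * suc m)             <⟨ ℤ.+<+ (S-geometric< (suc m) 1≤D) ⟩
    + (x ^ 3 * D * x)                 ≡⟨ ℤ.*-identityʳ (+ (x ^ 3 * D * x)) ⟨
    + (x ^ 3 * D * x) ℤ.* + 1         ∎))
  where
  open ℤ.≤-Reasoning
  rhs≡ : (+ (x ^ 3 * D) / 1) *ℚ (1ℚ +ℚ recip (suc m)) ≡ + (x ^ 3 * D * x) / suc m
  rhs≡ = trans (cong ((+ (x ^ 3 * D) / 1) *ℚ_) (1+recip-suc m)) (*ℚ-/ (x ^ 3 * D) x m)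

-- With T = m + 1 the hypothesis is (B − A) T > R (T − 1), i.e. B − A > R (1 − 1/T).
fraction-bound⁻ : ∀ A B R T → 0 < T → A * T + R * T < B * T + R →
  (+ R / 1) *ℚ (1ℚ -ℚ recip T) <ℚ + ∣ + A ℤ.- + B ∣ / 1
fraction-bound⁻ A B R (suc m) _ h =
  subst₂ _<ℚ_ (sym lhs≡) (cong (λ k → + k / 1) (sym (∣m-n∣≡n∸m (<⇒≤ (scaled-gap⇒< A B R m h)))))
    (/-<-/ (+ (R * m)) (+ (B ∸ A)) m 0 (begin-strict
      + (R * m) ℤ.* + 1        ≡⟨ ℤ.*-identityʳ (+ (R * m)) ⟩
      + (R * m)                <⟨ ℤ.+<+ (scaled-gap⇒∸-bound A B R m h) ⟩
      + ((B ∸ A) * suc m)      ≡⟨ ℤ.pos-* (B ∸ A) (suc m) ⟩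
      + (B ∸ A) ℤ.* + suc m    ∎))
  where
  open ℤ.≤-Reasoning
  lhs≡ : (+ R / 1) *ℚ (1ℚ -ℚ recip (suc m)) ≡ + (R * m) / suc m
  lhs≡ = trans (cong ((+ R / 1) *ℚ_) (1-recip-suc m)) (*ℚ-/ R m m)

a-^ : ∀ k ℓ n d → a k ℓ n d ≡ + (S (n ^ ℓ) 1 * (d ^ k) ^ 3) ℤ.- + (S (n ^ k) 1 * (d ^ ℓ) ^ 3)
a-^ k ℓ n d = cong₂ ℤ._-_
  (trans (sym (ℤ.pos-* (S n ℓ) (d ^ (3 * k)))) (cong +_ (cong₂ _*_ (S-^ n ℓ) (^-*-comm d 3 k))))
  (trans (sym (ℤ.pos-* (S n k) (d ^ (3 * ℓ)))) (cong +_ (cong₂ _*_ (S-^ n k) (^-*-comm d 3 ℓ))))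

a<bound : ∀ k ℓ n d → 1 ≤ ℓ → 2 ≤ n → 1 ≤ d →
  a k ℓ n d / 1 <ℚ (+ (n ^ (3 * ℓ) * d ^ (3 * k)) / 1) *ℚ (1ℚ +ℚ recip (n ^ ℓ ∸ 1))
a<bound k ℓ n d 1≤ℓ 1<n 0<d
  rewrite a-^ k ℓ n d | ^-*-comm n 3 ℓ | ^-*-comm d 3 k =
  fraction-bound⁺ x D (+ (S x 1 * D) ℤ.- + Q) (^-monoʳ-< n 1<n 1≤ℓ) (m^n>0 (d ^ k) 3)
    (ℤ.i-j≤i (+ (S x 1 * D)) (+ Q))
  where
  x = n ^ ℓ
  D = (d ^ k) ^ 3
  Q = S (n ^ k) 1 * (d ^ ℓ) ^ 3
  instance
    d≢0 : NonZero d
    d≢0 = >-nonZero 0<d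
    d^k≢0 : NonZero (d ^ k)
    d^k≢0 = m^n≢0 d k

∣a∣>bound : ∀ k ℓ n → k + 2 ≤ ℓ → 2 ≤ n →
  + ∣ a k ℓ n n ∣ / 1 >ℚ (+ (n ^ (2 * k + 3 * ℓ)) / 1) *ℚ (1ℚ -ℚ recip (n ^ 2))
∣a∣>bound k ℓ n k+2≤ℓ 1<n
  rewrite a-^ k ℓ n n | ^-distribˡ-+-* n (2 * k) (3 * ℓ) | ^-*-comm n 2 k | ^-*-comm n 3 ℓ =
  fraction-bound⁻ (S x 1 * u ^ 3) (S u 1 * x ^ 3) (u ^ 2 * x ^ 3) (n ^ 2)
    (m^n>0 n 2) (S-cross-gap u<x u*n²≤x (m^n>0 n 2))
  where
  u = n ^ k
  x = n ^ ℓ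
  instance
    n≢0 : NonZero n
    n≢0 = >-nonZero (<-trans z<s 1<n)
  u<x : u < x
  u<x = ^-monoʳ-< n 1<n (<-≤-trans (m<m+n k z<s) k+2≤ℓ)
  u*n²≤x : u * n ^ 2 ≤ x
  u*n²≤x = subst (_≤ x) (^-distribˡ-+-* n k 2) (^-monoʳ-≤ n k+2≤ℓ)

lemma3p3 : (k ℓ : ℕ) → Odd k → Odd ℓ → 1 ≤ k → k < ℓ →
    ((n d : ℕ) → 2 ≤ n → d ∣ n → 1 ≤ d → d < n →
    (a k ℓ n d / 1) <ℚ (((+ (n ^ (3 * ℓ) * d ^ (3 * k))) / 1) *ℚ (1ℚ +ℚ recip (n ^ ℓ ∸ 1))))
    × ((n : ℕ) → 2 ≤ n →
    ((+ ∣ a k ℓ n n ∣) / 1) >ℚ (((+ (n ^ (2 * k + 3 * ℓ))) / 1) *ℚ (1ℚ -ℚ recip (n ^ 2))))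
lemma3p3 k ℓ odd-k odd-ℓ 1≤k k<ℓ =
  (λ n d 2≤n _ 1≤d _ → a<bound k ℓ n d (≤-trans 1≤k (<⇒≤ k<ℓ)) 2≤n 1≤d) ,
  (λ n 2≤n → ∣a∣>bound k ℓ n (odd-gap odd-k odd-ℓ k<ℓ) 2≤n)
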